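{- Let $D$ be a point-determining digraph with at least one vertex. Then there exists at least one vertex of $D$ that is red in no triple of $D$.
   Context: Digraphs are finite, without loops and multiple arcs. For distinct vertices $u,v,w$ of a digraph $D$, $w$ distinguishes $u,v$ if exactly one of $u,v$ is an in-neighbour of $w$, or exactly one of $u,v$ is an out-neighbour of $w$. Distinct vertices $u,v$ are twins in $D$ if no vertex of $D$ distinguishes them; false twins if moreover neither $(u,v)$ nor $(v,u)$ is an arc. $D$ is point-determining if it has no pair of false twins. A triple $T=(x,\{y,z\})$ of a point-determining digraph $D$ consists of a vertex $x$ (the red vertex of $T$) and an unordered pair $\{y,z\}$ of distinct vertices other than $x$ (the green vertices of $T$) such that $y,z$ are false twins in $D-x$. -}

module Defs where

open import Data.Nat using (ℕ)
open import Data.Fin using (Fin)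
open import Data.Bool using (Bool; true; false)
open import Data.Product using (_×_; Σ)
open import Data.Sum using (_⊎_)
open import Relation.Binary.PropositionalEquality using (_≡_; _≢_)
open import Relation.Nullary using (¬_)

record Digraph (n : ℕ) : Set where
  field
    arc   : Fin n → Fin n → Bool
    loopless : ∀ v → arc v v ≡ false

open Digraph public

Arc : ∀ {n} → Digraph n → Fin n → Fin n → Set
Arc D u v = arc D u v ≡ true

XOr : Set → Set → Set
XOr P Q = (P × ¬ Q) ⊎ (Q × ¬ P)

Distinguishes : ∀ {n} → Digraph n → Fin n → Fin n → Fin n → Set
Distinguishes D w u v =
  w ≢ u × w ≢ v × u ≢ v ×
  (XOr (Arc D u w) (Arc D v w) ⊎ XOr (Arc D w u) (Arc D w v))

FalseTwins : ∀ {n} → Digraph n → Fin n → Fin n → Set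
FalseTwins D u v =
  u ≢ v × (∀ w → ¬ Distinguishes D w u v) × ¬ Arc D u v × ¬ Arc D v u

PointDetermining : ∀ {n} → Digraph n → Set
PointDetermining D = ∀ u v → ¬ FalseTwins D u v

-- u, v are false twins in D - x (vertex x deleted; u, v ≠ x):
-- only vertices other than x may distinguish them.
FalseTwinsMinus : ∀ {n} → Digraph n → Fin n → Fin n → Fin n → Set
FalseTwinsMinus D x u v =
  u ≢ x × v ≢ x × u ≢ v ×
  (∀ w → w ≢ x → ¬ Distinguishes D w u v) × ¬ Arc D u v × ¬ Arc D v u

-- T = (x, {y, z}) is a triple of D (D point-determining is a standing
-- assumption of the statement). The pair is unordered; the condition is
-- symmetric in y, z so we use ordered pairs.
IsTriple : ∀ {n} → Digraph n → Fin n → Fin n → Fin n → Set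
IsTriple D x y z = FalseTwinsMinus D x y z

RedInSomeTriple : ∀ {n} → Digraph n → Fin n → Set
RedInSomeTriple D x = Σ (Fin _) λ y → Σ (Fin _) λ z → IsTriple D x y z

-- For k ≤ N, call vertices u, v k-equivalent if they agree (have the same
-- arcs to and from) at every vertex of index ≥ k. If x is red in a triple
-- (x, {y, z}), then y and z agree at every vertex but x and, D being
-- point-determining, disagree at x; so when x has index k, y and z are
-- (k+1)-equivalent but not k-equivalent, and the (k+1)-classes are strictly
-- fewer than the k-classes. If every vertex were red, the number of classes
-- would fall N times from at most N, yet at k = N there is exactly one class.
module Submission where

open import Defs
open import Data.Bool using (Bool; true; false)
open import Data.Bool.Properties using (¬-not) renaming (_≟_ to _≟ᵇ_)
open import Data.Empty using (⊥-elim)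
open import Data.Fin using (Fin; toℕ; fromℕ<; inject; zero; _<_)
open import Data.Fin.Properties
  using (_≟_; all?; any?; ¬∀⟶∃¬; ¬∀⟶∃¬-smallest; <-cmp; toℕ-inject; toℕ-fromℕ<; toℕ-injective)
open import Data.Fin.Subset using (Subset; _∈_; _⊆_; _⊂_; ∣_∣)
open import Data.Fin.Subset.Properties using (p⊂q⇒∣p∣<∣q∣; ∣p∣≤n; x∈p⇒p-x⊂p)
open import Data.Nat as ℕ using (ℕ; suc; _≤_; _+_; z≤n)
import Data.Nat.Properties as ℕ
open import Data.Product using (Σ; _×_; _,_; proj₁; proj₂)
open import Data.Sum using (inj₁; inj₂)
open import Data.Vec using (tabulate)
open import Data.Vec.Properties using ([]=⇒lookup; lookup⇒[]=; lookup∘tabulate)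
open import Relation.Binary.Definitions using (Tri; tri<; tri≈; tri>)
open import Relation.Binary.PropositionalEquality using (_≡_; _≢_; refl; sym; trans; subst)
open import Relation.Nullary using (¬_; Dec; yes; no; does)
open import Relation.Nullary.Decidable using (_×-dec_; _⊎-dec_; _→-dec_; ¬?; dec-true; decidable-stable)
open import Relation.Unary using (Pred; Decidable)

≡⇒¬XOr : ∀ {a b : Bool} → a ≡ b → ¬ XOr (a ≡ true) (b ≡ true)
≡⇒¬XOr refl (inj₁ (a , ¬a)) = ¬a a
≡⇒¬XOr refl (inj₂ (b , ¬b)) = ¬b b

¬XOr⇒≡ : ∀ (a b : Bool) → ¬ XOr (a ≡ true) (b ≡ true) → a ≡ b
¬XOr⇒≡ true  true  _ = refl
¬XOr⇒≡ true  false h = ⊥-elim (h (inj₁ (refl , λ ())))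
¬XOr⇒≡ false true  h = ⊥-elim (h (inj₂ (refl , λ ())))
¬XOr⇒≡ false false _ = refl

XOr? : ∀ (a b : Bool) → Dec (XOr (a ≡ true) (b ≡ true))
XOr? a b = ((a ≟ᵇ true) ×-dec ¬? (b ≟ᵇ true)) ⊎-dec ((b ≟ᵇ true) ×-dec ¬? (a ≟ᵇ true))

inject-fromℕ< : ∀ {n} {i j : Fin n} (j<i : j < i) → inject (fromℕ< j<i) ≡ j
inject-fromℕ< j<i = toℕ-injective (trans (toℕ-inject (fromℕ< j<i)) (toℕ-fromℕ< j<i))

module _ {n ℓ} {P : Pred (Fin n) ℓ} (P? : Decidable P) where

  subset : Subset n
  subset = tabulate (λ i → does (P? i))

  ∈-subset⁺ : ∀ {i} → P i → i ∈ subset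
  ∈-subset⁺ {i} p = lookup⇒[]= i subset (trans (lookup∘tabulate _ i) (dec-true (P? i) p))

  ∈-subset⁻ : ∀ {i} → i ∈ subset → P i
  ∈-subset⁻ {i} i∈ with P? i | trans (sym (lookup∘tabulate (λ j → does (P? j)) i)) ([]=⇒lookup i∈)
  ... | yes p | _ = p
  ... | no _  | ()

0<∣p∣ : ∀ {n} {p : Subset n} {x} → x ∈ p → 0 ℕ.< ∣ p ∣
0<∣p∣ x∈p = ℕ.≤-<-trans z≤n (p⊂q⇒∣p∣<∣q∣ (x∈p⇒p-x⊂p x∈p))

decreasing⇒k+c[k]≤c[0] : ∀ (c : ℕ → ℕ) {N} → (∀ k → k ℕ.< N → c (suc k) ℕ.< c k) →
                         ∀ k → k ≤ N → k + c k ≤ c 0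
decreasing⇒k+c[k]≤c[0] c dec ℕ.zero    _   = ℕ.≤-refl
decreasing⇒k+c[k]≤c[0] c dec (suc k) k<N = ℕ.≤-trans step (decreasing⇒k+c[k]≤c[0] c dec k (ℕ.<⇒≤ k<N))
  where
  step : suc k + c (suc k) ≤ k + c k
  step = subst (_≤ k + c k) (ℕ.+-suc k (c (suc k))) (ℕ.+-monoʳ-≤ k (dec k k<N))

module _ {n : ℕ} (D : Digraph n) where

  AgreeAt : Fin n → Fin n → Fin n → Set
  AgreeAt w u v = arc D w u ≡ arc D w v × arc D u w ≡ arc D v w

  AgreeFrom : ℕ → Fin n → Fin n → Set
  AgreeFrom k u v = ∀ w → k ≤ toℕ w → AgreeAt w u v

  agreeFrom-refl : ∀ {k u} → AgreeFrom k u u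
  agreeFrom-refl _ _ = refl , refl

  agreeFrom-sym : ∀ {k u v} → AgreeFrom k u v → AgreeFrom k v u
  agreeFrom-sym uv w k≤w = sym (proj₁ (uv w k≤w)) , sym (proj₂ (uv w k≤w))

  agreeFrom-trans : ∀ {k u v t} → AgreeFrom k u v → AgreeFrom k v t → AgreeFrom k u t
  agreeFrom-trans uv vt w k≤w =
    trans (proj₁ (uv w k≤w)) (proj₁ (vt w k≤w)) , trans (proj₂ (uv w k≤w)) (proj₂ (vt w k≤w))

  agreeFrom-suc : ∀ {k u v} → AgreeFrom k u v → AgreeFrom (suc k) u v
  agreeFrom-suc uv w k<w = uv w (ℕ.<⇒≤ k<w)

  agreeFrom? : ∀ k u v → Dec (AgreeFrom k u v)
  agreeFrom? k u v = all? λ w →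
    (k ℕ.≤? toℕ w) →-dec ((arc D w u ≟ᵇ arc D w v) ×-dec (arc D u w ≟ᵇ arc D v w))

  LeastInClass : ℕ → Fin n → Set
  LeastInClass k v = ∀ u → u < v → ¬ AgreeFrom k u v

  leastInClass? : ∀ k → Decidable (LeastInClass k)
  leastInClass? k v = all? λ u → (toℕ u ℕ.<? toℕ v) →-dec ¬? (agreeFrom? k u v)

  least-exists : ∀ k v → Σ (Fin n) λ r → AgreeFrom k r v × LeastInClass k r
  least-exists k v with ¬∀⟶∃¬-smallest n (λ u → ¬ AgreeFrom k u v)
                          (λ u → ¬? (agreeFrom? k u v)) (λ h → h v agreeFrom-refl)
  ... | r , ¬¬rv , below = r , rv , least
    where
    rv : AgreeFrom k r v
    rv = decidable-stable (agreeFrom? k r v) ¬¬rv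
    least : LeastInClass k r
    least u u<r ur = below (fromℕ< u<r)
      (subst (λ t → AgreeFrom k t v) (sym (inject-fromℕ< u<r)) (agreeFrom-trans ur rv))

  classLeasts : ℕ → Subset n
  classLeasts k = subset (leastInClass? k)

  classLeasts-⊆ : ∀ k → classLeasts (suc k) ⊆ classLeasts k
  classLeasts-⊆ k r∈ = ∈-subset⁺ (leastInClass? k)
    λ u u<r ur → ∈-subset⁻ (leastInClass? (suc k)) r∈ u u<r (agreeFrom-suc ur)

  -- Of the least elements of the k-classes of y and z, the larger one is
  -- not least in its (k+1)-class.
  classLeasts-⊂ : ∀ k {y z} → AgreeFrom (suc k) y z → ¬ AgreeFrom k y z →
                  classLeasts (suc k) ⊂ classLeasts k
  classLeasts-⊂ k {y} {z} yz ¬yz with least-exists k y | least-exists k z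
  ... | a , ay , a-least | b , bz , b-least = classLeasts-⊆ k , larger (<-cmp a b)
    where
    ab : AgreeFrom (suc k) a b
    ab = agreeFrom-trans (agreeFrom-suc ay) (agreeFrom-trans yz (agreeFrom-sym (agreeFrom-suc bz)))
    dropped : ∀ {s t} → s < t → AgreeFrom (suc k) s t → LeastInClass k t →
              Σ (Fin n) λ r → r ∈ classLeasts k × ¬ r ∈ classLeasts (suc k)
    dropped {s} {t} s<t st t-least =
      t , ∈-subset⁺ (leastInClass? k) t-least ,
      λ t∈ → ∈-subset⁻ (leastInClass? (suc k)) t∈ s s<t st
    larger : Tri (a < b) (a ≡ b) (b < a) → Σ (Fin n) λ r → r ∈ classLeasts k × ¬ r ∈ classLeasts (suc k)
    larger (tri< a<b _ _) = dropped a<b ab b-least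
    larger (tri> _ _ b<a) = dropped b<a (agreeFrom-sym ab) a-least
    larger (tri≈ _ refl _) =
      ⊥-elim (¬yz (agreeFrom-trans (agreeFrom-sym ay) bz))

  distinguishes? : ∀ w u v → Dec (Distinguishes D w u v)
  distinguishes? w u v =
    ¬? (w ≟ u) ×-dec ¬? (w ≟ v) ×-dec ¬? (u ≟ v) ×-dec
    (XOr? (arc D u w) (arc D v w) ⊎-dec XOr? (arc D w u) (arc D w v))

  isTriple? : ∀ x y z → Dec (IsTriple D x y z)
  isTriple? x y z =
    ¬? (y ≟ x) ×-dec ¬? (z ≟ x) ×-dec ¬? (y ≟ z) ×-dec
    all? (λ w → ¬? (w ≟ x) →-dec ¬? (distinguishes? w y z)) ×-dec
    ¬? (arc D y z ≟ᵇ true) ×-dec ¬? (arc D z y ≟ᵇ true)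

  redInSomeTriple? : Decidable (RedInSomeTriple D)
  redInSomeTriple? x = any? λ y → any? λ z → isTriple? x y z

  triple-agreeAt : ∀ {x y z} → IsTriple D x y z → ∀ w → w ≢ x → AgreeAt w y z
  triple-agreeAt {x} {y} {z} (_ , _ , y≢z , undistinguished , ¬y→z , ¬z→y) w w≢x
    with w ≟ y | w ≟ z
  ... | yes refl | _ = trans (loopless D y) (sym (¬-not ¬y→z)) , trans (loopless D y) (sym (¬-not ¬z→y))
  ... | no _ | yes refl = trans (¬-not ¬z→y) (sym (loopless D z)) , trans (¬-not ¬y→z) (sym (loopless D z))
  ... | no w≢y | no w≢z =
    ¬XOr⇒≡ (arc D w y) (arc D w z) (λ out → undistinguished w w≢x (w≢y , w≢z , y≢z , inj₂ out)) ,
    ¬XOr⇒≡ (arc D y w) (arc D z w) (λ inn → undistinguished w w≢x (w≢y , w≢z , y≢z , inj₁ inn))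

  triple-¬agreeAt : PointDetermining D → ∀ {x y z} → IsTriple D x y z → ¬ AgreeAt x y z
  triple-¬agreeAt pd {x} {y} {z} (_ , _ , y≢z , undistinguished , ¬y→z , ¬z→y) (out , inn) =
    pd y z (y≢z , undistinguished′ , ¬y→z , ¬z→y)
    where
    undistinguished′ : ∀ w → ¬ Distinguishes D w y z
    undistinguished′ w with w ≟ x
    ... | no w≢x = undistinguished w w≢x
    ... | yes refl = λ where
      (_ , _ , _ , inj₁ xor) → ≡⇒¬XOr inn xor
      (_ , _ , _ , inj₂ xor) → ≡⇒¬XOr out xor

  red⇒fewerClasses : PointDetermining D → ∀ k (k<n : k ℕ.< n) → RedInSomeTriple D (fromℕ< k<n) →
                     ∣ classLeasts (suc k) ∣ ℕ.< ∣ classLeasts k ∣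
  red⇒fewerClasses pd k k<n (y , z , triple) = p⊂q⇒∣p∣<∣q∣ (classLeasts-⊂ k yz ¬yz)
    where
    index-x : k ≡ toℕ (fromℕ< k<n)
    index-x = sym (toℕ-fromℕ< k<n)
    yz : AgreeFrom (suc k) y z
    yz w k<w = triple-agreeAt triple w λ { refl → ℕ.<-irrefl index-x k<w }
    ¬yz : ¬ AgreeFrom k y z
    ¬yz yz = triple-¬agreeAt pd triple (yz _ (ℕ.≤-reflexive index-x))

lemma2 : (n : ℕ) (D : Digraph (suc n)) → PointDetermining D →
    Σ (Fin (suc n)) λ v → ¬ RedInSomeTriple D v
lemma2 n D pd = ¬∀⟶∃¬ (suc n) _ (redInSomeTriple? D) not-all-red
  where
  classes : ℕ → ℕ
  classes k = ∣ classLeasts D k ∣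
  0<classes[N] : 0 ℕ.< classes (suc n)
  0<classes[N] = 0<∣p∣ (∈-subset⁺ (leastInClass? D (suc n)) {zero} λ _ ())
  not-all-red : ¬ (∀ x → RedInSomeTriple D x)
  not-all-red all-red = ℕ.<-irrefl refl (begin-strict
    suc n                       <⟨ ℕ.m<m+n (suc n) 0<classes[N] ⟩
    suc n + classes (suc n)     ≤⟨ decreasing⇒k+c[k]≤c[0] classes fewer (suc n) ℕ.≤-refl ⟩
    classes 0                   ≤⟨ ∣p∣≤n (classLeasts D 0) ⟩
    suc n                       ∎)
    where
    open ℕ.≤-Reasoning
    fewer : ∀ k → k ℕ.< suc n → classes (suc k) ℕ.< classes k
    fewer k k<N = red⇒fewerClasses D pd k k<N (all-red _)
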